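{- Let $\mathcal{C}$ be a cartesian closed category with an adjunction of endofunctors $\Diamond\dashv\Box$ (unit $\eta^m$, counit $\varepsilon^m$) and a natural transformation $r:\mathrm{Id}\Rightarrow\Box$ with $\Box(r_A)=r_{\Box A}$ for all $A$, and let $q_A=\varepsilon^m_A\circ\Diamond r_A:\Diamond A\to A$. For all contexts $\Gamma,\Gamma'$ (with $\Gamma,\bullet,\Gamma'$ well formed), \[ (w_{\Gamma',\bullet})_{\Diamond[\![\Gamma]\!]} \;=\; \Diamond\big((w_{\bullet,\Gamma'})_{[\![\Gamma]\!]}\big) \quad:\ [\![\Gamma,\bullet,\Gamma',\bullet]\!]\to[\![\Gamma,\bullet]\!]. \]
   Context: Contexts: $\Gamma ::= \cdot \mid \Gamma,x:A \mid \Gamma,\bullet$, where $A$ ranges over types (built from atoms by $1,\times,\to,\Box,\Diamond$) and $\bullet$ is a structural symbol called a lock. Fix an interpretation $[\![A]\!]$ of types as objects of $\mathcal{C}$ (atoms arbitrary, the rest via the cartesian closed structure, $\Box$ and $\Diamond$). Each context $\Gamma$ denotes an endofunctor $[\![\Gamma]\!]$: $[\![\cdot]\!]=\mathrm{Id}$, $[\![\Gamma,x:A]\!](X)=[\![\Gamma]\!](X)\times[\![A]\!]$, $[\![\Gamma,\bullet]\!](X)=\Diamond([\![\Gamma]\!](X))$; as an object $[\![\Gamma]\!]=[\![\Gamma]\!](1)$, so $[\![\Gamma,\Gamma']\!]=[\![\Gamma']\!]([\![\Gamma]\!])$. The weakening natural transformations $w_\Gamma:[\![\Gamma]\!]\Rightarrow\mathrm{Id}$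 are defined by: $w_\cdot=\mathrm{id}$; $(w_{\Gamma,x:A})_X=(w_\Gamma)_X\circ\mathrm{pr}$ with $\mathrm{pr}:[\![\Gamma]\!](X)\times[\![A]\!]\to[\![\Gamma]\!](X)$; $(w_{\Gamma,\bullet})_X=(w_\Gamma)_X\circ q_{[\![\Gamma]\!](X)}$. -}

module Defs where

open import Level using (Level; _⊔_) renaming (suc to lsuc)
open import Relation.Binary using (IsEquivalence)
open import Relation.Binary.PropositionalEquality using (_≡_; refl; cong; subst)
open import Data.Nat using (ℕ)
open import Relation.Nullary using (¬_)
open import Data.Product using (_×_)
open import Data.Unit using (⊤)

record Category (o ℓ e : Level) : Set (lsuc (o ⊔ ℓ ⊔ e)) where
  infixr 9 _∘_
  infix 4 _≈_
  infixr 5 _⇒_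
  field
    Obj : Set o
    _⇒_ : Obj → Obj → Set ℓ
    _≈_ : ∀ {A B} → A ⇒ B → A ⇒ B → Set e
    id : ∀ {A} → A ⇒ A
    _∘_ : ∀ {A B C} → B ⇒ C → A ⇒ B → A ⇒ C
    ≈-equiv : ∀ {A B} → IsEquivalence (_≈_ {A} {B})
    ∘-resp-≈ : ∀ {A B C} {f h : B ⇒ C} {g i : A ⇒ B} → f ≈ h → g ≈ i → f ∘ g ≈ h ∘ i
    identityˡ : ∀ {A B} {f : A ⇒ B} → id ∘ f ≈ f
    identityʳ : ∀ {A B} {f : A ⇒ B} → f ∘ id ≈ f
    assoc : ∀ {A B C D} {f : A ⇒ B} {g : B ⇒ C} {h : C ⇒ D} →
            (h ∘ g) ∘ f ≈ h ∘ (g ∘ f)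

record Endofunctor {o ℓ e : Level} (C : Category o ℓ e) : Set (o ⊔ ℓ ⊔ e) where
  open Category C
  field
    F₀ : Obj → Obj
    F₁ : ∀ {A B} → A ⇒ B → F₀ A ⇒ F₀ B
    identity : ∀ {A} → F₁ (id {A}) ≈ id
    homomorphism : ∀ {A B D} {f : A ⇒ B} {g : B ⇒ D} → F₁ (g ∘ f) ≈ F₁ g ∘ F₁ f
    F-resp-≈ : ∀ {A B} {f g : A ⇒ B} → f ≈ g → F₁ f ≈ F₁ g

record CartesianClosed {o ℓ e : Level} (C : Category o ℓ e) : Set (o ⊔ ℓ ⊔ e) where
  open Category C
  infixr 7 _⊗_
  infixr 6 _⇨_
  field
    𝟙 : Obj
    ! : ∀ {A} → A ⇒ 𝟙
    !-unique : ∀ {A} (f : A ⇒ 𝟙) → ! ≈ f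
    _⊗_ : Obj → Obj → Obj
    π₁ : ∀ {A B} → A ⊗ B ⇒ A
    π₂ : ∀ {A B} → A ⊗ B ⇒ B
    ⟨_,_⟩ : ∀ {X A B} → X ⇒ A → X ⇒ B → X ⇒ A ⊗ B
    project₁ : ∀ {X A B} {f : X ⇒ A} {g : X ⇒ B} → π₁ ∘ ⟨ f , g ⟩ ≈ f
    project₂ : ∀ {X A B} {f : X ⇒ A} {g : X ⇒ B} → π₂ ∘ ⟨ f , g ⟩ ≈ g
    ⟨⟩-unique : ∀ {X A B} {f : X ⇒ A} {g : X ⇒ B} {h : X ⇒ A ⊗ B} →
                π₁ ∘ h ≈ f → π₂ ∘ h ≈ g → ⟨ f , g ⟩ ≈ h
    _⇨_ : Obj → Obj → Obj
    eval : ∀ {B D} → (B ⇨ D) ⊗ B ⇒ D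
    curry : ∀ {X B D} → X ⊗ B ⇒ D → X ⇒ B ⇨ D
    β : ∀ {X B D} {f : X ⊗ B ⇒ D} → eval ∘ ⟨ curry f ∘ π₁ , π₂ ⟩ ≈ f
    curry-unique : ∀ {X B D} {f : X ⊗ B ⇒ D} {h : X ⇒ B ⇨ D} →
                   eval ∘ ⟨ h ∘ π₁ , π₂ ⟩ ≈ f → h ≈ curry f

record ModalCCC (o ℓ e : Level) : Set (lsuc (o ⊔ ℓ ⊔ e)) where
  field
    C   : Category o ℓ e
    ccc : CartesianClosed C
    ◇F  : Endofunctor C
    □F  : Endofunctor C
  open Category C
  open Endofunctor ◇F renaming (F₀ to ◇₀; F₁ to ◇₁)
  open Endofunctor □F renaming (F₀ to □₀; F₁ to □₁)
  field
    ηᵐ : ∀ X → X ⇒ □₀ (◇₀ X)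
    ηᵐ-natural : ∀ {X Y} (f : X ⇒ Y) → ηᵐ Y ∘ f ≈ □₁ (◇₁ f) ∘ ηᵐ X
    εᵐ : ∀ X → ◇₀ (□₀ X) ⇒ X
    εᵐ-natural : ∀ {X Y} (f : X ⇒ Y) → εᵐ Y ∘ ◇₁ (□₁ f) ≈ f ∘ εᵐ X
    zig : ∀ X → εᵐ (◇₀ X) ∘ ◇₁ (ηᵐ X) ≈ id
    zag : ∀ X → □₁ (εᵐ X) ∘ ηᵐ (□₀ X) ≈ id
    r : ∀ X → X ⇒ □₀ X
    r-natural : ∀ {X Y} (f : X ⇒ Y) → r Y ∘ f ≈ □₁ f ∘ r X
    □r≡r□ : ∀ X → □₁ (r X) ≈ r (□₀ X)

data Ty (Atom : Set) : Set where
  atom : Atom → Ty Atom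
  𝟏    : Ty Atom
  _⊠_  : Ty Atom → Ty Atom → Ty Atom
  _⟶_  : Ty Atom → Ty Atom → Ty Atom
  □ₜ   : Ty Atom → Ty Atom
  ◇ₜ   : Ty Atom → Ty Atom

infixl 5 _,_∶_ _,• _++_

data Ctx (Atom : Set) : Set where
  ·      : Ctx Atom
  _,_∶_  : Ctx Atom → ℕ → Ty Atom → Ctx Atom
  _,•    : Ctx Atom → Ctx Atom

_++_ : ∀ {Atom} → Ctx Atom → Ctx Atom → Ctx Atom
Γ ++ · = Γ
Γ ++ (Δ , x ∶ A) = (Γ ++ Δ) , x ∶ A
Γ ++ (Δ ,•) = (Γ ++ Δ) ,•

Fresh : ∀ {Atom} → ℕ → Ctx Atom → Set
Fresh x · = ⊤
Fresh x (Γ , y ∶ A) = ¬ (x ≡ y) × Fresh x Γ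
Fresh x (Γ ,•) = Fresh x Γ

WF : ∀ {Atom} → Ctx Atom → Set
WF · = ⊤
WF (Γ , x ∶ A) = WF Γ × Fresh x Γ
WF (Γ ,•) = WF Γ

module Semantics {o ℓ e : Level} (M : ModalCCC o ℓ e)
                 {Atom : Set} (⟦_⟧ₐ : Atom → Category.Obj (ModalCCC.C M)) where
  open ModalCCC M
  open Category C
  open CartesianClosed ccc
  open Endofunctor ◇F renaming (F₀ to ◇₀; F₁ to ◇₁)
  open Endofunctor □F renaming (F₀ to □₀; F₁ to □₁)

  q : ∀ X → ◇₀ X ⇒ X
  q X = εᵐ X ∘ ◇₁ (r X)

  ⟦_⟧ₜ : Ty Atom → Obj
  ⟦ atom a ⟧ₜ = ⟦ a ⟧ₐ
  ⟦ 𝟏 ⟧ₜ = 𝟙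
  ⟦ A ⊠ B ⟧ₜ = ⟦ A ⟧ₜ ⊗ ⟦ B ⟧ₜ
  ⟦ A ⟶ B ⟧ₜ = ⟦ A ⟧ₜ ⇨ ⟦ B ⟧ₜ
  ⟦ □ₜ A ⟧ₜ = □₀ ⟦ A ⟧ₜ
  ⟦ ◇ₜ A ⟧ₜ = ◇₀ ⟦ A ⟧ₜ

  ⟦_⟧F : Ctx Atom → Obj → Obj
  ⟦ · ⟧F X = X
  ⟦ Γ , x ∶ A ⟧F X = ⟦ Γ ⟧F X ⊗ ⟦ A ⟧ₜ
  ⟦ Γ ,• ⟧F X = ◇₀ (⟦ Γ ⟧F X)

  ⟦_⟧c : Ctx Atom → Obj
  ⟦ Γ ⟧c = ⟦ Γ ⟧F 𝟙

  -- weakening natural transformation w_Γ : ⟦Γ⟧ ⇒ Id (components)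
  w : (Γ : Ctx Atom) (X : Obj) → ⟦ Γ ⟧F X ⇒ X
  w · X = id
  w (Γ , x ∶ A) X = w Γ X ∘ π₁
  w (Γ ,•) X = w Γ X ∘ q (⟦ Γ ⟧F X)

  ⟦++⟧ : ∀ Γ Δ X → ⟦ Γ ++ Δ ⟧F X ≡ ⟦ Δ ⟧F (⟦ Γ ⟧F X)
  ⟦++⟧ Γ · X = refl
  ⟦++⟧ Γ (Δ , x ∶ A) X = cong (λ Y → Y ⊗ ⟦ A ⟧ₜ) (⟦++⟧ Γ Δ X)
  ⟦++⟧ Γ (Δ ,•) X = cong ◇₀ (⟦++⟧ Γ Δ X)

  castDom : ∀ {A A' B} → A ≡ A' → A ⇒ B → A' ⇒ B
  castDom p f = subst (λ Z → Z ⇒ _) p f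

module Submission where

open import Level using (Level)
open import Relation.Binary.Bundles using (Setoid)
open import Relation.Binary.Structures using (IsEquivalence)
open import Relation.Binary.PropositionalEquality using (_≡_; refl; cong)
import Relation.Binary.Reasoning.Setoid as SetoidReasoning
open import Defs

-- Weakening through Γ ++ Γ' factors as w_Γ ∘ w_Γ', so the left-hand side is q ∘ ◇ w_Γ'
-- (naturality of q) and the right-hand side is ◇ q ∘ ◇ w_Γ'.  They agree because
-- ◇ q_A = q_{◇A}, which follows from η_A ∘ q_A = r_{◇A}: this is where □ r = r □ is used.

module _ {o ℓ e : Level} (M : ModalCCC o ℓ e) {Atom : Set}
         (⟦_⟧ₐ : Atom → Category.Obj (ModalCCC.C M)) where
  open ModalCCC M
  open Category C
  open CartesianClosed ccc using (_⊗_; π₁)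
  open Endofunctor ◇F renaming (F₀ to ◇₀; F₁ to ◇₁; homomorphism to ◇-homomorphism; F-resp-≈ to ◇-resp-≈)
  open Endofunctor □F renaming (F₀ to □₀; F₁ to □₁)
  open Semantics M ⟦_⟧ₐ

  hom-setoid : Obj → Obj → Setoid ℓ e
  hom-setoid A B = record { Carrier = A ⇒ B ; _≈_ = _≈_ ; isEquivalence = ≈-equiv }

  private
    module ≈ {A B : Obj} = IsEquivalence (≈-equiv {A} {B})
    module HomReasoning {A B : Obj} = SetoidReasoning (hom-setoid A B)
  open HomReasoning

  ∘-resp-≈ˡ : ∀ {A B D} {f g : B ⇒ D} {h : A ⇒ B} → f ≈ g → f ∘ h ≈ g ∘ h
  ∘-resp-≈ˡ p = ∘-resp-≈ p ≈.refl

  ∘-resp-≈ʳ : ∀ {A B D} {f : B ⇒ D} {g h : A ⇒ B} → g ≈ h → f ∘ g ≈ f ∘ h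
  ∘-resp-≈ʳ p = ∘-resp-≈ ≈.refl p

  ≡⇒≈ : ∀ {A B} {f g : A ⇒ B} → f ≡ g → f ≈ g
  ≡⇒≈ refl = ≈.refl

  q-natural : ∀ {A B} (f : A ⇒ B) → q B ∘ ◇₁ f ≈ f ∘ q A
  q-natural {A} {B} f = begin
    (εᵐ B ∘ ◇₁ (r B)) ∘ ◇₁ f   ≈⟨ assoc ⟩
    εᵐ B ∘ ◇₁ (r B) ∘ ◇₁ f     ≈⟨ ∘-resp-≈ʳ ◇-homomorphism ⟨
    εᵐ B ∘ ◇₁ (r B ∘ f)        ≈⟨ ∘-resp-≈ʳ (◇-resp-≈ (r-natural f)) ⟩
    εᵐ B ∘ ◇₁ (□₁ f ∘ r A)     ≈⟨ ∘-resp-≈ʳ ◇-homomorphism ⟩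
    εᵐ B ∘ ◇₁ (□₁ f) ∘ ◇₁ (r A) ≈⟨ assoc ⟨
    (εᵐ B ∘ ◇₁ (□₁ f)) ∘ ◇₁ (r A) ≈⟨ ∘-resp-≈ˡ (εᵐ-natural f) ⟩
    (f ∘ εᵐ A) ∘ ◇₁ (r A)      ≈⟨ assoc ⟩
    f ∘ q A                    ∎

  ηᵐ∘q≈r◇ : ∀ A → ηᵐ A ∘ q A ≈ r (◇₀ A)
  ηᵐ∘q≈r◇ A = begin
    ηᵐ A ∘ εᵐ A ∘ ◇₁ (r A)                            ≈⟨ assoc ⟨
    (ηᵐ A ∘ εᵐ A) ∘ ◇₁ (r A)                          ≈⟨ ∘-resp-≈ˡ (εᵐ-natural (ηᵐ A)) ⟨
    (εᵐ (□₀ (◇₀ A)) ∘ ◇₁ (□₁ (ηᵐ A))) ∘ ◇₁ (r A)      ≈⟨ assoc ⟩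
    εᵐ (□₀ (◇₀ A)) ∘ ◇₁ (□₁ (ηᵐ A)) ∘ ◇₁ (r A)        ≈⟨ ∘-resp-≈ʳ ◇-homomorphism ⟨
    εᵐ (□₀ (◇₀ A)) ∘ ◇₁ (□₁ (ηᵐ A) ∘ r A)             ≈⟨ ∘-resp-≈ʳ (◇-resp-≈ (r-natural (ηᵐ A))) ⟨
    εᵐ (□₀ (◇₀ A)) ∘ ◇₁ (r (□₀ (◇₀ A)) ∘ ηᵐ A)        ≈⟨ ∘-resp-≈ʳ (◇-resp-≈ (∘-resp-≈ˡ (□r≡r□ (◇₀ A)))) ⟨
    εᵐ (□₀ (◇₀ A)) ∘ ◇₁ (□₁ (r (◇₀ A)) ∘ ηᵐ A)        ≈⟨ ∘-resp-≈ʳ ◇-homomorphism ⟩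
    εᵐ (□₀ (◇₀ A)) ∘ ◇₁ (□₁ (r (◇₀ A))) ∘ ◇₁ (ηᵐ A)   ≈⟨ assoc ⟨
    (εᵐ (□₀ (◇₀ A)) ∘ ◇₁ (□₁ (r (◇₀ A)))) ∘ ◇₁ (ηᵐ A) ≈⟨ ∘-resp-≈ˡ (εᵐ-natural (r (◇₀ A))) ⟩
    (r (◇₀ A) ∘ εᵐ (◇₀ A)) ∘ ◇₁ (ηᵐ A)                ≈⟨ assoc ⟩
    r (◇₀ A) ∘ εᵐ (◇₀ A) ∘ ◇₁ (ηᵐ A)                  ≈⟨ ∘-resp-≈ʳ (zig A) ⟩
    r (◇₀ A) ∘ id                                     ≈⟨ identityʳ ⟩
    r (◇₀ A)                                          ∎

  ◇q≈q◇ : ∀ A → ◇₁ (q A) ≈ q (◇₀ A)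
  ◇q≈q◇ A = begin
    ◇₁ (q A)                                 ≈⟨ identityˡ ⟨
    id ∘ ◇₁ (q A)                            ≈⟨ ∘-resp-≈ˡ (zig A) ⟨
    (εᵐ (◇₀ A) ∘ ◇₁ (ηᵐ A)) ∘ ◇₁ (q A)       ≈⟨ assoc ⟩
    εᵐ (◇₀ A) ∘ ◇₁ (ηᵐ A) ∘ ◇₁ (q A)         ≈⟨ ∘-resp-≈ʳ ◇-homomorphism ⟨
    εᵐ (◇₀ A) ∘ ◇₁ (ηᵐ A ∘ q A)              ≈⟨ ∘-resp-≈ʳ (◇-resp-≈ (ηᵐ∘q≈r◇ A)) ⟩
    q (◇₀ A)                                 ∎

  castDom-cong-∘ : ∀ (F : Obj → Obj) (g : ∀ X → F X ⇒ X) {A A' B} (p : A ≡ A') (f : A ⇒ B) →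
                   castDom (cong F p) (f ∘ g A) ≡ castDom p f ∘ g A'
  castDom-cong-∘ F g refl f = refl

  w-++ : ∀ Γ Δ X → castDom (⟦++⟧ Γ Δ X) (w (Γ ++ Δ) X) ≈ w Γ X ∘ w Δ (⟦ Γ ⟧F X)
  w-++ Γ · X = ≈.sym identityʳ
  w-++ Γ (Δ , x ∶ A) X = begin
    castDom (⟦++⟧ Γ (Δ , x ∶ A) X) (w (Γ ++ Δ) X ∘ π₁)
      ≈⟨ ≡⇒≈ (castDom-cong-∘ (λ Y → Y ⊗ ⟦ A ⟧ₜ) (λ _ → π₁) (⟦++⟧ Γ Δ X) (w (Γ ++ Δ) X)) ⟩
    castDom (⟦++⟧ Γ Δ X) (w (Γ ++ Δ) X) ∘ π₁  ≈⟨ ∘-resp-≈ˡ (w-++ Γ Δ X) ⟩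
    (w Γ X ∘ w Δ (⟦ Γ ⟧F X)) ∘ π₁            ≈⟨ assoc ⟩
    w Γ X ∘ w Δ (⟦ Γ ⟧F X) ∘ π₁              ∎
  w-++ Γ (Δ ,•) X = begin
    castDom (⟦++⟧ Γ (Δ ,•) X) (w (Γ ++ Δ) X ∘ q (⟦ Γ ++ Δ ⟧F X))
      ≈⟨ ≡⇒≈ (castDom-cong-∘ ◇₀ q (⟦++⟧ Γ Δ X) (w (Γ ++ Δ) X)) ⟩
    castDom (⟦++⟧ Γ Δ X) (w (Γ ++ Δ) X) ∘ q (⟦ Δ ⟧F (⟦ Γ ⟧F X)) ≈⟨ ∘-resp-≈ˡ (w-++ Γ Δ X) ⟩
    (w Γ X ∘ w Δ (⟦ Γ ⟧F X)) ∘ q (⟦ Δ ⟧F (⟦ Γ ⟧F X))           ≈⟨ assoc ⟩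
    w Γ X ∘ w Δ (⟦ Γ ⟧F X) ∘ q (⟦ Δ ⟧F (⟦ Γ ⟧F X))             ∎

  w-lock-swap : ∀ Δ X → w (Δ ,•) (◇₀ X) ≈ ◇₁ (castDom (⟦++⟧ (· ,•) Δ X) (w ((· ,•) ++ Δ) X))
  w-lock-swap Δ X = begin
    w Δ (◇₀ X) ∘ q (⟦ Δ ⟧F (◇₀ X))  ≈⟨ q-natural (w Δ (◇₀ X)) ⟨
    q (◇₀ X) ∘ ◇₁ (w Δ (◇₀ X))      ≈⟨ ∘-resp-≈ˡ (◇q≈q◇ X) ⟨
    ◇₁ (q X) ∘ ◇₁ (w Δ (◇₀ X))      ≈⟨ ◇-homomorphism ⟨
    ◇₁ (q X ∘ w Δ (◇₀ X))           ≈⟨ ◇-resp-≈ (∘-resp-≈ˡ identityˡ) ⟨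
    ◇₁ ((id ∘ q X) ∘ w Δ (◇₀ X))    ≈⟨ ◇-resp-≈ (w-++ (· ,•) Δ X) ⟨
    ◇₁ (castDom (⟦++⟧ (· ,•) Δ X) (w ((· ,•) ++ Δ) X)) ∎

-- Weakening ignores variable names.
lemma14 : ∀ {o ℓ e : Level} (M : ModalCCC o ℓ e) {Atom : Set}
    (⟦_⟧ₐ : Atom → Category.Obj (ModalCCC.C M))
    (Γ Γ' : Ctx Atom) → WF ((Γ ,•) ++ Γ') →
    let open Semantics M ⟦_⟧ₐ in
    Category._≈_ (ModalCCC.C M)
    (w (Γ' ,•) (Endofunctor.F₀ (ModalCCC.◇F M) ⟦ Γ ⟧c))
    (Endofunctor.F₁ (ModalCCC.◇F M)
    (castDom (⟦++⟧ (· ,•) Γ' ⟦ Γ ⟧c) (w ((· ,•) ++ Γ') ⟦ Γ ⟧c)))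
lemma14 M ⟦_⟧ₐ Γ Γ' _ = w-lock-swap M ⟦_⟧ₐ Γ' (Semantics.⟦_⟧c M ⟦_⟧ₐ Γ)
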